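{- Let $D$ be an arc-colored digraph of order $n\geq 4$ containing no rainbow triangle, and let $v\in V(D)$ be such that $D-v$ is isomorphic to the complete digraph $\overleftrightarrow{K}_{n-1}$ and $d^{s}(v)\geq 3$. Then $CN^{ - }(v)\cap C^{s}(v)=\emptyset$ or $CN^{+}(v)\cap C^{s}(v)=\emptyset$. Moreover, if $D$ is isomorphic to $\overleftrightarrow{K}_4$, then $c(D)\leq 5$.
   Context: Digraphs are finite, without loops or multiple arcs; $\overleftrightarrow{K}_{m}$ is the complete digraph on $m$ vertices (every ordered pair of distinct vertices joined by an arc). An arc-coloring is a map $C:A(D)\to\mathbb{N}$, $c(D)$ is the number of colors used. For a vertex $v$, $CN^{ - }(v)$ (resp. $CN^{+}(v)$) is the set of colors on arcs entering (resp. leaving) $v$. A color $c$ is saturated by $v$ if every arc of color $c$ is incident to $v$; $C^{s}(v)$ is the set of colors saturated by $v$ and $d^{s}(v)=|C^{s}(v)|$. A rainbow triangle is a directed $3$-cycle with pairwise distinct arc colors. -}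

module Defs where

open import Data.Nat using (ℕ; _≤_; _≡ᵇ_)
import Data.Nat as ℕ
open import Data.Fin using (Fin)
import Data.Fin as F
open import Data.Bool using (Bool; true; false; _∨_; _∧_; not)
open import Data.List using (List; map; filterᵇ; deduplicate; cartesianProduct; _∷_; []; length; allFin)
open import Data.List.Membership.Propositional using (_∈_)
open import Data.Product using (_×_; _,_)
open import Relation.Binary.PropositionalEquality using (_≡_; _≢_)
open import Relation.Nullary using (¬_; ⌊_⌋)
open import Data.Empty using (⊥)

record Digraph (n : ℕ) : Set where
  field
    adj      : Fin n → Fin n → Bool
    loopless : ∀ i → adj i i ≡ false
open Digraph public

Arc : ∀ {n} → Digraph n → Fin n → Fin n → Set
Arc D i j = adj D i j ≡ true

-- An arc-coloring; only its values on arcs of D are ever used.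
Coloring : ℕ → Set
Coloring n = Fin n → Fin n → ℕ

arcs : ∀ {n} → Digraph n → List (Fin n × Fin n)
arcs {n} D = filterᵇ (λ { (i , j) → adj D i j }) (cartesianProduct (allFin n) (allFin n))

colorOf : ∀ {n} → Coloring n → Fin n × Fin n → ℕ
colorOf C (i , j) = C i j

colorsUsed : ∀ {n} → Digraph n → Coloring n → List ℕ
colorsUsed D C = deduplicate ℕ._≟_ (map (colorOf C) (arcs D))

numColors : ∀ {n} → Digraph n → Coloring n → ℕ
numColors D C = length (colorsUsed D C)

CNin : ∀ {n} → Digraph n → Coloring n → Fin n → List ℕ
CNin D C v = map (colorOf C) (filterᵇ (λ { (i , j) → ⌊ j F.≟ v ⌋ }) (arcs D))

CNout : ∀ {n} → Digraph n → Coloring n → Fin n → List ℕ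
CNout D C v = map (colorOf C) (filterᵇ (λ { (i , j) → ⌊ i F.≟ v ⌋ }) (arcs D))

allᵇ : {A : Set} → (A → Bool) → List A → Bool
allᵇ p [] = true
allᵇ p (x ∷ xs) = p x ∧ allᵇ p xs

incidentᵇ : ∀ {n} → Fin n → Fin n × Fin n → Bool
incidentᵇ v (i , j) = ⌊ i F.≟ v ⌋ ∨ ⌊ j F.≟ v ⌋

saturatedᵇ : ∀ {n} → Digraph n → Coloring n → Fin n → ℕ → Bool
saturatedᵇ D C v c = allᵇ (λ e → not (colorOf C e ≡ᵇ c) ∨ incidentᵇ v e) (arcs D)

Csat : ∀ {n} → Digraph n → Coloring n → Fin n → List ℕ
Csat D C v = filterᵇ (saturatedᵇ D C v) (colorsUsed D C)

dsat : ∀ {n} → Digraph n → Coloring n → Fin n → ℕ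
dsat D C v = length (Csat D C v)

Disjoint : List ℕ → List ℕ → Set
Disjoint xs ys = ∀ c → c ∈ xs → c ∈ ys → ⊥

NoRainbowTriangle : ∀ {n} → Digraph n → Coloring n → Set
NoRainbowTriangle D C = ∀ x y z → Arc D x y → Arc D y z → Arc D z x →
  ¬ (C x y ≢ C y z × C y z ≢ C z x × C x y ≢ C z x)

MinusIsComplete : ∀ {n} → Digraph n → Fin n → Set
MinusIsComplete D v = ∀ i j → i ≢ v → j ≢ v → i ≢ j → Arc D i j

IsComplete : ∀ {n} → Digraph n → Set
IsComplete D = ∀ i j → i ≢ j → Arc D i j

-- A colour saturated by v lives only on arcs at v. If x → v and v → y carry saturated colours
-- and x ≠ y, the arc y → x avoids v, so its colour is unsaturated and differs from both; since
-- x → v → y → x is not rainbow, the two saturated colours coincide. So if saturated colours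
-- occur both on arcs into and out of v, a short case check leaves room for only two of them,
-- against d^s(v) ≥ 3.
-- In K₄ with, say, three saturated colours on the arcs v → w₁, w₂, w₃, the triangles
-- v → i → j → v force C i j = C j v for i, j ≠ v, so every colour is some C v wₖ or C wₖ v;
-- and w₁ → w₂ → w₃ → w₁, coloured C w₂ v, C w₃ v, C w₁ v, is not rainbow, so only five remain.
-- The other case is the same argument for the reversed colouring.
module Submission where

open import Defs
open import Data.Nat using (ℕ; _≤_; s≤s; z≤n; _≡ᵇ_; zero; suc)
import Data.Nat as ℕ
import Data.Nat.Properties as ℕ
open import Data.Fin using (Fin)
import Data.Fin as F
open import Data.Fin.Properties using (all?)
open import Data.Product using (_×_; _,_; ∃-syntax; proj₁; proj₂)
open import Data.Sum using (_⊎_; inj₁; inj₂)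
open import Data.Bool using (Bool; true; T; _∨_; not)
open import Data.List using (List; []; _∷_; length; map; filter; cartesianProduct; allFin)
open import Data.List.Membership.Propositional using (_∈_; find)
open import Data.List.Membership.Propositional.Properties
open import Data.List.Relation.Unary.Any using (here; there)
import Data.List.Relation.Unary.Any as Any
open import Data.List.Relation.Unary.All using (_∷_)
import Data.List.Relation.Unary.All as All
open import Data.List.Relation.Unary.AllPairs using (_∷_)
open import Data.List.Relation.Unary.Unique.Propositional using (Unique)
import Data.List.Relation.Unary.Unique.Propositional.Properties as Unique
import Data.List.Relation.Unary.Unique.DecPropositional.Properties as Unique
open import Data.List.Properties using (filter-notAll)
open import Data.List.Membership.DecPropositional ℕ._≟_ using (_∈?_)
open import Relation.Binary.Definitions using (DecidableEquality)
open import Relation.Binary.PropositionalEquality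
open import Relation.Nullary
open import Relation.Nullary.Decidable using (toWitness; fromWitness; _⊎-dec_; _→-dec_)
open import Data.Empty using (⊥; ⊥-elim)
open import Data.Bool.Properties using (T-≡)
open import Function.Base using (flip)
open import Function.Bundles using (Equivalence)

module _ {A : Set} (_≟_ : DecidableEquality A) where

  unique-⊆⇒length≤ : {xs ys : List A} → Unique xs → (∀ {x} → x ∈ xs → x ∈ ys) →
    length xs ≤ length ys
  unique-⊆⇒length≤ {[]} _ _ = z≤n
  unique-⊆⇒length≤ {x ∷ xs} {ys} (x∉xs ∷ xs!) xs⊆ys =
    ℕ.≤-trans (s≤s (unique-⊆⇒length≤ xs! xs⊆ys∖x)) (filter-notAll ≢x? ys x∈ys)
    where
    ≢x? : ∀ y → Dec (x ≢ y)
    ≢x? y = ¬? (x ≟ y)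
    x∈ys : Any.Any (λ y → ¬ (x ≢ y)) ys
    x∈ys = Any.map (λ { refl x≢x → x≢x refl }) (xs⊆ys (here refl))
    xs⊆ys∖x : ∀ {z} → z ∈ xs → z ∈ filter ≢x? ys
    xs⊆ys∖x z∈xs = ∈-filter⁺ ≢x? (xs⊆ys (there z∈xs)) (All.lookup x∉xs z∈xs)

three-distinct : {A : Set} {xs : List A} → Unique xs → 3 ≤ length xs →
  ∃[ a ] ∃[ b ] ∃[ c ] a ≢ b × a ≢ c × b ≢ c × a ∈ xs × b ∈ xs × c ∈ xs
three-distinct {xs = _ ∷ []} _ (s≤s ())
three-distinct {xs = _ ∷ _ ∷ []} _ (s≤s (s≤s ()))
three-distinct {xs = a ∷ b ∷ c ∷ _} ((a≢b ∷ a≢c ∷ _) ∷ (b≢c ∷ _) ∷ _) _ =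
  a , b , c , a≢b , a≢c , b≢c , here refl , there (here refl) , there (there (here refl))

disjoint⊎common : (xs ys : List ℕ) → Disjoint xs ys ⊎ ∃[ c ] c ∈ xs × c ∈ ys
disjoint⊎common xs ys with Any.any? (_∈? ys) xs
... | yes common = inj₂ (find common)
... | no ¬common = inj₁ λ c c∈xs c∈ys → ¬common (Any.map (λ { refl → c∈ys }) c∈xs)

not-distinct : {a b c : ℕ} → ¬ (a ≢ b × b ≢ c × a ≢ c) → a ≡ b ⊎ b ≡ c ⊎ a ≡ c
not-distinct {a} {b} {c} ¬distinct with a ℕ.≟ b | b ℕ.≟ c | a ℕ.≟ c
... | yes a≡b | _ | _ = inj₁ a≡b
... | no _ | yes b≡c | _ = inj₂ (inj₁ b≡c)
... | no _ | no _ | yes a≡c = inj₂ (inj₂ a≡c)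
... | no a≢b | no b≢c | no a≢c = ⊥-elim (¬distinct (a≢b , b≢c , a≢c))

allᵇ-∈ : {A : Set} (p : A → Bool) {xs : List A} {x : A} → allᵇ p xs ≡ true → x ∈ xs → p x ≡ true
allᵇ-∈ p {y ∷ _} h x∈xs with p y in py | h | x∈xs
... | true | _  | here refl = py
... | true | h' | there x∈ys = allᵇ-∈ p h' x∈ys

≡ᵇ-refl-∨ : (m : ℕ) {b : Bool} → (not (m ≡ᵇ m) ∨ b) ≡ true → b ≡ true
≡ᵇ-refl-∨ zero h = h
≡ᵇ-refl-∨ (suc m) h = ≡ᵇ-refl-∨ m h

module Colouring {n : ℕ} (D : Digraph n) (C : Coloring n) (v : Fin n) where

  Saturated : ℕ → Set
  Saturated c = c ∈ Csat D C v

  private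
    arc? : (e : Fin n × Fin n) → Dec (T (adj D (proj₁ e) (proj₂ e)))
    arc? e = T? (adj D (proj₁ e) (proj₂ e))

    saturated? : (c : ℕ) → Dec (T (saturatedᵇ D C v c))
    saturated? c = T? (saturatedᵇ D C v c)

  arc⇒≢ : ∀ {i j} → Arc D i j → i ≢ j
  arc⇒≢ {i} a refl with () ← trans (sym (loopless D i)) a

  arc⇒∈arcs : ∀ {i j} → Arc D i j → (i , j) ∈ arcs D
  arc⇒∈arcs a = ∈-filter⁺ arc? (∈-cartesianProduct⁺ (∈-allFin _) (∈-allFin _)) (Equivalence.from T-≡ a)

  ∈arcs⇒arc : ∀ {i j} → (i , j) ∈ arcs D → Arc D i j
  ∈arcs⇒arc e∈arcs =
    Equivalence.to T-≡ (proj₂ (∈-filter⁻ arc? {xs = cartesianProduct (allFin n) (allFin n)} e∈arcs))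

  used⇒arc : ∀ {c} → c ∈ colorsUsed D C → ∃[ i ] ∃[ j ] Arc D i j × C i j ≡ c
  used⇒arc c∈ with ∈-map⁻ (colorOf C) (∈-deduplicate⁻ ℕ._≟_ (map (colorOf C) (arcs D)) c∈)
  ... | (i , j) , e∈arcs , refl = i , j , ∈arcs⇒arc e∈arcs , refl

  colorsUsed-unique : Unique (colorsUsed D C)
  colorsUsed-unique = Unique.deduplicate-! ℕ._≟_ (map (colorOf C) (arcs D))

  Csat-unique : Unique (Csat D C v)
  Csat-unique = Unique.filter⁺ saturated? colorsUsed-unique

  saturated⇒used : ∀ {c} → Saturated c → c ∈ colorsUsed D C
  saturated⇒used c∈ = proj₁ (∈-filter⁻ saturated? c∈)

  saturated⇒incidentᵇ : ∀ {i j} → Arc D i j → Saturated (C i j) → incidentᵇ v (i , j) ≡ true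
  saturated⇒incidentᵇ {i} {j} a sat = ≡ᵇ-refl-∨ (C i j) (allᵇ-∈ _ all-saturated (arc⇒∈arcs a))
    where
    all-saturated : saturatedᵇ D C v (C i j) ≡ true
    all-saturated = Equivalence.to T-≡ (proj₂ (∈-filter⁻ saturated? {xs = colorsUsed D C} sat))

  saturated⇒incident : ∀ {i j} → Arc D i j → Saturated (C i j) → i ≡ v ⊎ j ≡ v
  saturated⇒incident {i} {j} a sat with i F.≟ v | j F.≟ v | saturated⇒incidentᵇ a sat
  ... | yes i≡v | _ | _ = inj₁ i≡v
  ... | no _ | yes j≡v | _ = inj₂ j≡v
  ... | no _ | no _ | ()

  unsaturated-away-from-v : ∀ {i j} → i ≢ v → j ≢ v → Arc D i j → ¬ Saturated (C i j)
  unsaturated-away-from-v i≢v j≢v a sat with saturated⇒incident a sat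
  ... | inj₁ i≡v = i≢v i≡v
  ... | inj₂ j≡v = j≢v j≡v

  ∈CNin⇒arc : ∀ {c} → c ∈ CNin D C v → ∃[ x ] Arc D x v × C x v ≡ c
  ∈CNin⇒arc c∈ with ∈-map⁻ (colorOf C) c∈
  ... | (x , y) , e∈ , refl with ∈-filter⁻ _ e∈
  ... | e∈arcs , y≡v with toWitness {a? = y F.≟ v} y≡v
  ... | refl = x , ∈arcs⇒arc e∈arcs , refl

  ∈CNout⇒arc : ∀ {c} → c ∈ CNout D C v → ∃[ y ] Arc D v y × C v y ≡ c
  ∈CNout⇒arc c∈ with ∈-map⁻ (colorOf C) c∈
  ... | (x , y) , e∈ , refl with ∈-filter⁻ _ e∈
  ... | e∈arcs , x≡v with toWitness {a? = x F.≟ v} x≡v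
  ... | refl = y , ∈arcs⇒arc e∈arcs , refl

  arc⇒∈CNin : ∀ {x} → Arc D x v → C x v ∈ CNin D C v
  arc⇒∈CNin a = ∈-map⁺ (colorOf C) (∈-filter⁺ _ (arc⇒∈arcs a) (fromWitness {a? = v F.≟ v} refl))

  arc⇒∈CNout : ∀ {y} → Arc D v y → C v y ∈ CNout D C v
  arc⇒∈CNout a = ∈-map⁺ (colorOf C) (∈-filter⁺ _ (arc⇒∈arcs a) (fromWitness {a? = v F.≟ v} refl))

  data SaturatedArc : ℕ → Set where
    into  : ∀ {x} → Arc D x v → Saturated (C x v) → SaturatedArc (C x v)
    outof : ∀ {y} → Arc D v y → Saturated (C v y) → SaturatedArc (C v y)

  saturated⇒arc : ∀ {c} → Saturated c → SaturatedArc c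
  saturated⇒arc sat with used⇒arc (saturated⇒used sat)
  ... | i , j , a , refl with saturated⇒incident a sat
  ... | inj₁ refl = outof a sat
  ... | inj₂ refl = into a sat

  saturated⇒out-of : Disjoint (CNin D C v) (Csat D C v) → ∀ {c} → Saturated c → ∃[ y ] Arc D v y × C v y ≡ c
  saturated⇒out-of in-disjoint sat with saturated⇒arc sat
  ... | into ax _ = ⊥-elim (in-disjoint _ (arc⇒∈CNin ax) sat)
  ... | outof ay _ = _ , ay , refl

  saturated⇒into : Disjoint (CNout D C v) (Csat D C v) → ∀ {c} → Saturated c → ∃[ x ] Arc D x v × C x v ≡ c
  saturated⇒into out-disjoint sat with saturated⇒arc sat
  ... | into ax _ = _ , ax , refl
  ... | outof ay _ = ⊥-elim (out-disjoint _ (arc⇒∈CNout ay) sat)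

  module _ (no-rainbow : NoRainbowTriangle D C) (complete : MinusIsComplete D v) where

    saturated-in-out-meet : ∀ {x y} → Arc D x v → Saturated (C x v) → Arc D v y → Saturated (C v y) →
      C x v ≢ C v y → x ≡ y
    saturated-in-out-meet {x} {y} ax sx ay sy colours-differ with x F.≟ y
    ... | yes x≡y = x≡y
    ... | no x≢y = ⊥-elim (no-rainbow x v y ax ay ayx
          (colours-differ , (λ e → unsat (subst Saturated e sy)) , (λ e → unsat (subst Saturated e sx))))
      where
      ayx : Arc D y x
      ayx = complete y x (λ y≡v → arc⇒≢ ay (sym y≡v)) (arc⇒≢ ax) (≢-sym x≢y)
      unsat : ¬ Saturated (C y x)
      unsat = unsaturated-away-from-v (λ y≡v → arc⇒≢ ay (sym y≡v)) (arc⇒≢ ax) ayx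

    into-colours-agree : ∀ {x x' y} → Arc D x v → Saturated (C x v) → Arc D x' v → Saturated (C x' v) →
      Arc D v y → Saturated (C v y) → C x v ≢ C v y → C x' v ≢ C v y → C x v ≡ C x' v
    into-colours-agree ax sx ax' sx' ay sy ≢y ≢y'
      with refl ← saturated-in-out-meet ax sx ay sy ≢y
         | refl ← saturated-in-out-meet ax' sx' ay sy ≢y' = refl

    outof-colours-agree : ∀ {x y y'} → Arc D v y → Saturated (C v y) → Arc D v y' → Saturated (C v y') →
      Arc D x v → Saturated (C x v) → C x v ≢ C v y → C x v ≢ C v y' → C v y ≡ C v y'
    outof-colours-agree ay sy ay' sy' ax sx x≢ x≢'
      with refl ← saturated-in-out-meet ax sx ay sy x≢
         | refl ← saturated-in-out-meet ax sx ay' sy' x≢' = refl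

    three-into-contradict-outof : ∀ {x₁ x₂ x₃ y} →
      Arc D x₁ v → Saturated (C x₁ v) → Arc D x₂ v → Saturated (C x₂ v) → Arc D x₃ v → Saturated (C x₃ v) →
      Arc D v y → Saturated (C v y) →
      C x₁ v ≢ C x₂ v → C x₁ v ≢ C x₃ v → C x₂ v ≢ C x₃ v → ⊥
    -- C v y equals at most one of the three colours; the other two in-arcs then share their colour
    three-into-contradict-outof {x₁} {x₂} {y = y} a₁ s₁ a₂ s₂ a₃ s₃ ay sy ≢₁₂ ≢₁₃ ≢₂₃
      with C x₁ v ℕ.≟ C v y | C x₂ v ℕ.≟ C v y
    ... | yes ≡₁ | _ = ≢₂₃ (into-colours-agree a₂ s₂ a₃ s₃ ay sy
                              (λ e → ≢₁₂ (trans ≡₁ (sym e))) (λ e → ≢₁₃ (trans ≡₁ (sym e))))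
    ... | no ≢₁ | yes ≡₂ = ≢₁₃ (into-colours-agree a₁ s₁ a₃ s₃ ay sy ≢₁ (λ e → ≢₂₃ (trans ≡₂ (sym e))))
    ... | no ≢₁ | no ≢₂ = ≢₁₂ (into-colours-agree a₁ s₁ a₂ s₂ ay sy ≢₁ ≢₂)

    three-outof-contradict-into : ∀ {y₁ y₂ y₃ x} →
      Arc D v y₁ → Saturated (C v y₁) → Arc D v y₂ → Saturated (C v y₂) → Arc D v y₃ → Saturated (C v y₃) →
      Arc D x v → Saturated (C x v) →
      C v y₁ ≢ C v y₂ → C v y₁ ≢ C v y₃ → C v y₂ ≢ C v y₃ → ⊥
    three-outof-contradict-into {y₁} {y₂} {x = x} a₁ s₁ a₂ s₂ a₃ s₃ ax sx ≢₁₂ ≢₁₃ ≢₂₃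
      with C x v ℕ.≟ C v y₁ | C x v ℕ.≟ C v y₂
    ... | yes ≡₁ | _ = ≢₂₃ (outof-colours-agree a₂ s₂ a₃ s₃ ax sx
                              (λ e → ≢₁₂ (trans (sym ≡₁) e)) (λ e → ≢₁₃ (trans (sym ≡₁) e)))
    ... | no ≢₁ | yes ≡₂ = ≢₁₃ (outof-colours-agree a₁ s₁ a₃ s₃ ax sx ≢₁ (λ e → ≢₂₃ (trans (sym ≡₂) e)))
    ... | no ≢₁ | no ≢₂ = ≢₁₂ (outof-colours-agree a₁ s₁ a₂ s₂ ax sx ≢₁ ≢₂)

    two-sided-saturation⇒no-three-colours : ∀ {x y a b c} →
      Arc D x v → Saturated (C x v) → Arc D v y → Saturated (C v y) →
      SaturatedArc a → SaturatedArc b → SaturatedArc c → a ≢ b → a ≢ c → b ≢ c → ⊥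
    two-sided-saturation⇒no-three-colours ax sx ay sy (into a₁ s₁) (into a₂ s₂) (into a₃ s₃) ≢ab ≢ac ≢bc =
      three-into-contradict-outof a₁ s₁ a₂ s₂ a₃ s₃ ay sy ≢ab ≢ac ≢bc
    two-sided-saturation⇒no-three-colours ax sx ay sy (outof a₁ s₁) (outof a₂ s₂) (outof a₃ s₃) ≢ab ≢ac ≢bc =
      three-outof-contradict-into a₁ s₁ a₂ s₂ a₃ s₃ ax sx ≢ab ≢ac ≢bc
    two-sided-saturation⇒no-three-colours _ _ _ _ (into a₁ s₁) (into a₂ s₂) (outof a₃ s₃) ≢ab ≢ac ≢bc =
      ≢ab (into-colours-agree a₁ s₁ a₂ s₂ a₃ s₃ ≢ac ≢bc)
    two-sided-saturation⇒no-three-colours _ _ _ _ (into a₁ s₁) (outof a₂ s₂) (into a₃ s₃) ≢ab ≢ac ≢bc =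
      ≢ac (into-colours-agree a₁ s₁ a₃ s₃ a₂ s₂ ≢ab (≢-sym ≢bc))
    two-sided-saturation⇒no-three-colours _ _ _ _ (outof a₁ s₁) (into a₂ s₂) (into a₃ s₃) ≢ab ≢ac ≢bc =
      ≢bc (into-colours-agree a₂ s₂ a₃ s₃ a₁ s₁ (≢-sym ≢ab) (≢-sym ≢ac))
    two-sided-saturation⇒no-three-colours _ _ _ _ (outof a₁ s₁) (outof a₂ s₂) (into a₃ s₃) ≢ab ≢ac ≢bc =
      ≢ab (outof-colours-agree a₁ s₁ a₂ s₂ a₃ s₃ (≢-sym ≢ac) (≢-sym ≢bc))
    two-sided-saturation⇒no-three-colours _ _ _ _ (outof a₁ s₁) (into a₂ s₂) (outof a₃ s₃) ≢ab ≢ac ≢bc =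
      ≢ac (outof-colours-agree a₁ s₁ a₃ s₃ a₂ s₂ (≢-sym ≢ab) ≢bc)
    two-sided-saturation⇒no-three-colours _ _ _ _ (into a₁ s₁) (outof a₂ s₂) (outof a₃ s₃) ≢ab ≢ac ≢bc =
      ≢bc (outof-colours-agree a₂ s₂ a₃ s₃ a₁ s₁ ≢ab ≢ac)

    saturated-in-or-out-disjoint : 3 ≤ dsat D C v →
      Disjoint (CNin D C v) (Csat D C v) ⊎ Disjoint (CNout D C v) (Csat D C v)
    saturated-in-or-out-disjoint three-sat
      with disjoint⊎common (CNin D C v) (Csat D C v) | disjoint⊎common (CNout D C v) (Csat D C v)
    ... | inj₁ in-disjoint | _ = inj₁ in-disjoint
    ... | inj₂ _ | inj₁ out-disjoint = inj₂ out-disjoint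
    ... | inj₂ (_ , ∈in , sx) | inj₂ (_ , ∈out , sy)
      with x , ax , refl ← ∈CNin⇒arc ∈in | y , ay , refl ← ∈CNout⇒arc ∈out
      with a , b , c , ≢ab , ≢ac , ≢bc , sa , sb , sc ← three-distinct Csat-unique three-sat
      = ⊥-elim (two-sided-saturation⇒no-three-colours ax sx ay sy
          (saturated⇒arc sa) (saturated⇒arc sb) (saturated⇒arc sc) ≢ab ≢ac ≢bc)

  numColors≤length : {L : List ℕ} → (∀ {i j} → Arc D i j → C i j ∈ L) → numColors D C ≤ length L
  numColors≤length {L} arc⇒∈L = unique-⊆⇒length≤ ℕ._≟_ colorsUsed-unique used⇒∈L
    where
    used⇒∈L : ∀ {c} → c ∈ colorsUsed D C → c ∈ L
    used⇒∈L c∈ with i , j , a , refl ← used⇒arc c∈ = arc⇒∈L a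

-- Colourings of K₄ are bare functions, so that reversing every arc is just flip.
NoRainbowK₄ : (Fin 4 → Fin 4 → ℕ) → Set
NoRainbowK₄ C = ∀ x y z → x ≢ y → y ≢ z → z ≢ x → ¬ (C x y ≢ C y z × C y z ≢ C z x × C x y ≢ C z x)

NoRainbowK₄-flip : ∀ {C} → NoRainbowK₄ C → NoRainbowK₄ (flip C)
NoRainbowK₄-flip no-rainbow x y z x≢y y≢z z≢x (≢₁ , ≢₂ , ≢₃) =
  no-rainbow x z y (≢-sym z≢x) (≢-sym y≢z) (≢-sym x≢y) (≢-sym ≢₂ , ≢-sym ≢₁ , ≢-sym ≢₃)

Covers : (v w₁ w₂ w₃ : Fin 4) → Set
Covers v w₁ w₂ w₃ = ∀ x → x ≡ v ⊎ x ≡ w₁ ⊎ x ≡ w₂ ⊎ x ≡ w₃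

-- abstract, so that the 4⁵-case decision behind it is never unfolded where it is used
abstract
  distinct⇒covers : ∀ v w₁ w₂ w₃ → v ≢ w₁ → v ≢ w₂ → v ≢ w₃ → w₁ ≢ w₂ → w₁ ≢ w₃ → w₂ ≢ w₃ → Covers v w₁ w₂ w₃
  distinct⇒covers = toWitness {a? = all? λ v → all? λ w₁ → all? λ w₂ → all? λ w₃ →
    ¬? (v F.≟ w₁) →-dec ¬? (v F.≟ w₂) →-dec ¬? (v F.≟ w₃) →-dec
    ¬? (w₁ F.≟ w₂) →-dec ¬? (w₁ F.≟ w₃) →-dec ¬? (w₂ F.≟ w₃) →-dec
    all? λ x → (x F.≟ v) ⊎-dec (x F.≟ w₁) ⊎-dec (x F.≟ w₂) ⊎-dec (x F.≟ w₃)} _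

module _ {C : Fin 4 → Fin 4 → ℕ} {v : Fin 4}
         (toward-v : ∀ i j → i ≢ v → j ≢ v → i ≢ j → C i j ≡ C j v) where

  module _ {w₁ w₂ w₃ : Fin 4} (covers : Covers v w₁ w₂ w₃) (≡₂₃ : C w₂ v ≡ C w₃ v) where

    five-colours : List ℕ
    five-colours = C v w₁ ∷ C v w₂ ∷ C v w₃ ∷ C w₁ v ∷ C w₂ v ∷ []

    into-v-∈five : ∀ i → i ≢ v → C i v ∈ five-colours
    into-v-∈five i i≢v with covers i
    ... | inj₁ i≡v = ⊥-elim (i≢v i≡v)
    ... | inj₂ (inj₁ refl) = there (there (there (here refl)))
    ... | inj₂ (inj₂ (inj₁ refl)) = there (there (there (there (here refl))))
    ... | inj₂ (inj₂ (inj₂ refl)) = there (there (there (there (here (sym ≡₂₃)))))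

    out-of-v-∈five : ∀ j → j ≢ v → C v j ∈ five-colours
    out-of-v-∈five j j≢v with covers j
    ... | inj₁ j≡v = ⊥-elim (j≢v j≡v)
    ... | inj₂ (inj₁ refl) = here refl
    ... | inj₂ (inj₂ (inj₁ refl)) = there (here refl)
    ... | inj₂ (inj₂ (inj₂ refl)) = there (there (here refl))

    colour-∈five : ∀ i j → i ≢ j → C i j ∈ five-colours
    colour-∈five i j i≢j with i F.≟ v | j F.≟ v
    ... | yes refl | _ = out-of-v-∈five j (≢-sym i≢j)
    ... | no i≢v | yes refl = into-v-∈five i i≢v
    ... | no i≢v | no j≢v = subst (_∈ five-colours) (sym (toward-v i j i≢v j≢v i≢j)) (into-v-∈five j j≢v)

  at-most-five-colours : NoRainbowK₄ C → ∀ {w₁ w₂ w₃} →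
    v ≢ w₁ → v ≢ w₂ → v ≢ w₃ → w₁ ≢ w₂ → w₁ ≢ w₃ → w₂ ≢ w₃ →
    ∃[ L ] length L ≤ 5 × (∀ i j → i ≢ j → C i j ∈ L)
  at-most-five-colours no-rainbow {w₁} {w₂} {w₃} ≢₁ ≢₂ ≢₃ ≢₁₂ ≢₁₃ ≢₂₃
    with not-distinct triangle-not-rainbow
    -- relabel w₁ w₂ w₃ cyclically so that the repeated colour is C w₂ v = C w₃ v
    where
    triangle-not-rainbow : ¬ (C w₂ v ≢ C w₃ v × C w₃ v ≢ C w₁ v × C w₂ v ≢ C w₁ v)
    triangle-not-rainbow
      rewrite sym (toward-v w₁ w₂ (≢-sym ≢₁) (≢-sym ≢₂) ≢₁₂)
            | sym (toward-v w₂ w₃ (≢-sym ≢₂) (≢-sym ≢₃) ≢₂₃)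
            | sym (toward-v w₃ w₁ (≢-sym ≢₃) (≢-sym ≢₁) (≢-sym ≢₁₃))
      = no-rainbow w₁ w₂ w₃ ≢₁₂ ≢₂₃ (≢-sym ≢₁₃)
  ... | inj₁ ≡₂₃ =
    _ , ℕ.≤-refl , colour-∈five (distinct⇒covers _ _ _ _ ≢₁ ≢₂ ≢₃ ≢₁₂ ≢₁₃ ≢₂₃) ≡₂₃
  ... | inj₂ (inj₁ ≡₃₁) =
    _ , ℕ.≤-refl , colour-∈five (distinct⇒covers _ _ _ _ ≢₂ ≢₃ ≢₁ ≢₂₃ (≢-sym ≢₁₂) (≢-sym ≢₁₃)) ≡₃₁
  ... | inj₂ (inj₂ ≡₂₁) =
    _ , ℕ.≤-refl , colour-∈five (distinct⇒covers _ _ _ _ ≢₃ ≢₁ ≢₂ (≢-sym ≢₁₃) (≢-sym ≢₂₃) ≢₁₂) (sym ≡₂₁)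

module _ {C : Fin 4 → Fin 4 → ℕ} (no-rainbow : NoRainbowK₄ C) (Saturated : ℕ → Set) {v : Fin 4}
         (in-unsaturated : ∀ i → i ≢ v → ¬ Saturated (C i v))
         (away-unsaturated : ∀ i j → i ≢ v → j ≢ v → i ≢ j → ¬ Saturated (C i j)) where

  toward-v-of-out-saturated : (∀ i → i ≢ v → Saturated (C v i)) →
    ∀ i j → i ≢ v → j ≢ v → i ≢ j → C i j ≡ C j v
  toward-v-of-out-saturated out-saturated i j i≢v j≢v i≢j
    with not-distinct (no-rainbow v i j (≢-sym i≢v) i≢j j≢v)
  ... | inj₁ vi≡ij = ⊥-elim (away-unsaturated i j i≢v j≢v i≢j (subst Saturated vi≡ij (out-saturated i i≢v)))
  ... | inj₂ (inj₁ ij≡jv) = ij≡jv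
  ... | inj₂ (inj₂ vi≡jv) = ⊥-elim (in-unsaturated j j≢v (subst Saturated vi≡jv (out-saturated i i≢v)))

  three-out-saturated⇒at-most-five-colours : ∀ {w₁ w₂ w₃} →
    v ≢ w₁ → v ≢ w₂ → v ≢ w₃ → w₁ ≢ w₂ → w₁ ≢ w₃ → w₂ ≢ w₃ →
    Saturated (C v w₁) → Saturated (C v w₂) → Saturated (C v w₃) →
    ∃[ L ] length L ≤ 5 × (∀ i j → i ≢ j → C i j ∈ L)
  three-out-saturated⇒at-most-five-colours {w₁} {w₂} {w₃} ≢₁ ≢₂ ≢₃ ≢₁₂ ≢₁₃ ≢₂₃ s₁ s₂ s₃ =
    at-most-five-colours (toward-v-of-out-saturated out-saturated) no-rainbow ≢₁ ≢₂ ≢₃ ≢₁₂ ≢₁₃ ≢₂₃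
    where
    out-saturated : ∀ i → i ≢ v → Saturated (C v i)
    out-saturated i i≢v with distinct⇒covers v w₁ w₂ w₃ ≢₁ ≢₂ ≢₃ ≢₁₂ ≢₁₃ ≢₂₃ i
    ... | inj₁ i≡v = ⊥-elim (i≢v i≡v)
    ... | inj₂ (inj₁ refl) = s₁
    ... | inj₂ (inj₂ (inj₁ refl)) = s₂
    ... | inj₂ (inj₂ (inj₂ refl)) = s₃

module _ (D : Digraph 4) (C : Coloring 4) (v : Fin 4)
         (complete : IsComplete D) (no-rainbow : NoRainbowTriangle D C) where

  open Colouring D C v

  private
    no-rainbow-K₄ : NoRainbowK₄ C
    no-rainbow-K₄ x y z x≢y y≢z z≢x =
      no-rainbow x y z (complete x y x≢y) (complete y z y≢z) (complete z x z≢x)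

    away-unsaturated : ∀ i j → i ≢ v → j ≢ v → i ≢ j → ¬ Saturated (C i j)
    away-unsaturated i j i≢v j≢v i≢j = unsaturated-away-from-v i≢v j≢v (complete i j i≢j)

  three-saturated⇒five-colours-cover : ∀ {a b c} → a ≢ b → a ≢ c → b ≢ c →
    Saturated a → Saturated b → Saturated c →
    Disjoint (CNin D C v) (Csat D C v) ⊎ Disjoint (CNout D C v) (Csat D C v) →
    ∃[ L ] length L ≤ 5 × (∀ i j → i ≢ j → C i j ∈ L)
  three-saturated⇒five-colours-cover ≢ab ≢ac ≢bc sa sb sc (inj₁ in-disjoint)
    with w₁ , a₁ , refl ← saturated⇒out-of in-disjoint sa
       | w₂ , a₂ , refl ← saturated⇒out-of in-disjoint sb
       | w₃ , a₃ , refl ← saturated⇒out-of in-disjoint sc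
    = three-out-saturated⇒at-most-five-colours no-rainbow-K₄ Saturated
        (λ i i≢v → in-disjoint _ (arc⇒∈CNin (complete i v i≢v))) away-unsaturated
        (arc⇒≢ a₁) (arc⇒≢ a₂) (arc⇒≢ a₃)
        (λ { refl → ≢ab refl }) (λ { refl → ≢ac refl }) (λ { refl → ≢bc refl }) sa sb sc
  three-saturated⇒five-colours-cover ≢ab ≢ac ≢bc sa sb sc (inj₂ out-disjoint)
    with w₁ , a₁ , refl ← saturated⇒into out-disjoint sa
       | w₂ , a₂ , refl ← saturated⇒into out-disjoint sb
       | w₃ , a₃ , refl ← saturated⇒into out-disjoint sc
    with L , length≤5 , colours∈L ← three-out-saturated⇒at-most-five-colours
        (NoRainbowK₄-flip no-rainbow-K₄) Saturated
        (λ i i≢v → out-disjoint _ (arc⇒∈CNout (complete v i (≢-sym i≢v))))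
        (λ i j i≢v j≢v i≢j → away-unsaturated j i j≢v i≢v (≢-sym i≢j))
        (≢-sym (arc⇒≢ a₁)) (≢-sym (arc⇒≢ a₂)) (≢-sym (arc⇒≢ a₃))
        (λ { refl → ≢ab refl }) (λ { refl → ≢ac refl }) (λ { refl → ≢bc refl }) sa sb sc
    = L , length≤5 , λ i j i≢j → colours∈L j i (≢-sym i≢j)

  complete-K₄-at-most-five-colours : 3 ≤ dsat D C v →
    Disjoint (CNin D C v) (Csat D C v) ⊎ Disjoint (CNout D C v) (Csat D C v) → numColors D C ≤ 5
  complete-K₄-at-most-five-colours three-sat one-sided
    with a , b , c , ≢ab , ≢ac , ≢bc , sa , sb , sc ← three-distinct Csat-unique three-sat
    with L , length≤5 , colours∈L ← three-saturated⇒five-colours-cover ≢ab ≢ac ≢bc sa sb sc one-sided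
    = ℕ.≤-trans (numColors≤length (λ a → colours∈L _ _ (arc⇒≢ a))) length≤5

lemma1 : (n : ℕ) → 4 ≤ n → (D : Digraph n) → (C : Coloring n) →
    NoRainbowTriangle D C → (v : Fin n) → MinusIsComplete D v → 3 ≤ dsat D C v →
    (Disjoint (CNin D C v) (Csat D C v) ⊎ Disjoint (CNout D C v) (Csat D C v))
    × (n ≡ 4 → IsComplete D → numColors D C ≤ 5)
lemma1 n _ D C no-rainbow v complete-minus three-sat = one-sided , K₄-bound
  where
  one-sided : Disjoint (CNin D C v) (Csat D C v) ⊎ Disjoint (CNout D C v) (Csat D C v)
  one-sided = Colouring.saturated-in-or-out-disjoint D C v no-rainbow complete-minus three-sat
  K₄-bound : n ≡ 4 → IsComplete D → numColors D C ≤ 5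
  K₄-bound refl complete = complete-K₄-at-most-five-colours D C v complete no-rainbow three-sat one-sided
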